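{- Let $k\ge1$ be an integer. For all $N_0\in\mathcal{M}(k,0)$ and $N_1\in\mathcal{M}(k,1)$ there exists a $k$-affine pattern $B$ such that every evaluation of $B$ contains an $N_i$-instance for some $i\in\{0,1\}$.
   Context: A binary projective space is a set $V=W\setminus\{0\}$ where $W$ is a finite-dimensional $\mathbb{F}_2$-vector space; $\dim(V)=\dim_{\mathbb{F}_2}(W)$. A subspace is $U\setminus\{0\}$ with $U\le W$ linear; codimension is the difference of dimensions. A linear injection between binary projective spaces is the restriction of an injective linear map of the underlying vector spaces. A matroid is a function $M:V(M)\to\{0,1\}$ with $V(M)$ a binary projective space. For $k\ge0$ and $i\in\{0,1\}$, $\mathcal{M}(k,i)$ is the set of matroids $N$ such that $N$ is identically $i$ on some subspace of $V(N)$ of codimension at most $k$. A pattern is a function $B:V(B)\to\{0,1,\star\}$ with $V(B)$ a binary projective space; it is $k$-affine ($k\ge1$) if $B^{ -1}(\star)$ is a subspace of codimension $k$. A matroid $N$ is an evaluation of $B$ if $V(N)=V(B)$ and $B^{ -1}(i)\subseteq N^{ -1}(i)$ for $i\in\{0,1\}$. For matroids $N,M$, an $N$-instance in $M$ is a linear injection $\phi:V(N)\to V(M)$ with $M(\phi(x))=N(x)$ for all $x$. -}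

module Defs where

open import Data.Nat using (ℕ; _+_; _≤_)
open import Data.Bool using (Bool; true; false; _xor_)
open import Data.Vec using (Vec; replicate; zipWith)
open import Data.Product using (Σ; ∃; _×_; _,_)
open import Relation.Binary.PropositionalEquality using (_≡_; _≢_)

-- The underlying F₂-vector space of dimension n is Vec Bool n
-- (false = 0, true = 1, addition = pointwise xor).
-- The binary projective space of dimension n is its set of nonzero vectors.
-- Every binary projective space is linearly isomorphic to one of these, and all
-- notions below are invariant under linear isomorphism.

zeroV : (n : ℕ) → Vec Bool n
zeroV n = replicate n false

_⊕_ : {n : ℕ} → Vec Bool n → Vec Bool n → Vec Bool n
x ⊕ y = zipWith _xor_ x y

NonZero : {n : ℕ} → Vec Bool n → Set
NonZero {n} x = x ≢ zeroV n

-- Linear maps over F₂ are exactly the additive maps.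
IsLinear : {m n : ℕ} → (Vec Bool m → Vec Bool n) → Set
IsLinear f = ∀ x y → f (x ⊕ y) ≡ f x ⊕ f y

IsInjective : {m n : ℕ} → (Vec Bool m → Vec Bool n) → Set
IsInjective f = ∀ x y → f x ≡ f y → x ≡ y

-- injective linear map F₂^m → F₂^n (its restriction to nonzero vectors is a
-- linear injection of binary projective spaces)
IsLinearInjection : {m n : ℕ} → (Vec Bool m → Vec Bool n) → Set
IsLinearInjection f = IsLinear f × IsInjective f

-- A matroid: a {0,1}-valued function on the projective space of dimension dim.
-- Represented as a function on all of F₂^dim; its value at the zero vector is
-- irrelevant and is never inspected by any definition below.
record Matroid : Set where
  constructor mkMatroid
  field
    dim : ℕ
    fun : Vec Bool dim → Bool
open Matroid public

-- A subspace of dimension d of the projective space of dimension n is the set of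
-- nonzero vectors in the image of an injective linear map F₂^d → F₂^n;
-- its codimension is n - d.
-- N ∈ 𝓜(k,i): N is identically i on some subspace of codimension ≤ k.
InM : ℕ → Bool → Matroid → Set
InM k i N =
  Σ ℕ λ d → Σ (Vec Bool d → Vec Bool (dim N)) λ ι →
    IsLinearInjection ι × (dim N ≤ d + k) ×
    (∀ y → NonZero y → fun N (ι y) ≡ i)

data PVal : Set where
  val : Bool → PVal
  ⋆   : PVal

record Pattern : Set where
  constructor mkPattern
  field
    pdim : ℕ
    pfun : Vec Bool pdim → PVal
open Pattern public

-- B is k-affine: B⁻¹(⋆) is a subspace of codimension exactly k, i.e. there is an
-- injective linear ι : F₂^d → F₂^(pdim B) with d + k = pdim B such that for each
-- nonzero x, B x = ⋆ iff x lies in the image of ι.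
IsAffine : ℕ → Pattern → Set
IsAffine k B =
  Σ ℕ λ d → Σ (Vec Bool d → Vec Bool (pdim B)) λ ι →
    IsLinearInjection ι × (d + k ≡ pdim B) ×
    (∀ x → NonZero x → (pfun B x ≡ ⋆ → ∃ λ y → ι y ≡ x)
                      × (∃ (λ y → ι y ≡ x) → pfun B x ≡ ⋆))

IsEvaluation : (B : Pattern) → (Vec Bool (pdim B) → Bool) → Set
IsEvaluation B g = ∀ x → NonZero x → ∀ i → pfun B x ≡ val i → g x ≡ i

Instance : Matroid → Matroid → Set
Instance N M =
  Σ (Vec Bool (dim N) → Vec Bool (dim M)) λ φ →
    IsLinearInjection φ × (∀ x → NonZero x → fun M (φ x) ≡ fun N x)

Vec→Bool : Pattern → Set
Vec→Bool B = Vec Bool (pdim B) → Bool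

-- By the Ramsey theorem for F₂-vector spaces (a consequence of the pigeonhole principle
-- applied to truth tables), every 2-colouring of F₂ˢ, s large, has a monochromatic
-- subspace of dimension t = dim N₀ + dim N₁. The pattern lives on F₂ᵏ × F₂ˢ × (F₂ᴸ)ᵏ and
-- is ⋆ exactly where the F₂ᵏ-coordinate a vanishes. At (a, p, q) with a ≠ 0 it reads the
-- block of q indexed by the first nonzero coordinate of a as a side i and a matrix
-- K : F₂ˢ → F₂ᵗ, and takes the value of N_i at (the i-th block of) K p.
-- Given an evaluation g, colour p ∈ F₂ˢ by g(0, p, 0) and take a monochromatic subspace
-- M, of colour i say. If N_i is identically i on the kernel of α : V(N_i) → F₂ᵏ, then
-- x ↦ (α x, M x, α x ⊗ (i, M⁻¹)) is an N_i-instance: if α x = 0 the point lies in the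
-- ⋆-subspace, where g has the colour i of M, and otherwise the pattern decodes M⁻¹ M x = x.

module Submission where

open import Defs
open import Data.Nat using (ℕ; zero; suc; _+_; _*_; _≤_; _<_; z≤n; s≤s)
open import Data.Nat.Properties using (+-suc; +-comm; m<m+n; m≤m+n; m≤n+m; <-≤-trans)
open import Data.Bool using (Bool; true; false; _xor_; if_then_else_)
open import Data.Bool.Properties using (_≟_; xor-assoc; xor-comm; xor-identityˡ; xor-identityʳ; xor-same)
open import Data.Vec using (Vec; []; _∷_; _++_; head; tail; take; drop; padRight; truncate; lookup; tabulate)
open import Data.Vec.Properties
  using (zipWith-assoc; zipWith-comm; zipWith-identityˡ; zipWith-identityʳ; zipWith-++;
         take++drop≡id; ≡-dec; ++-injectiveˡ; ++-injectiveʳ; ++-injective; truncate-padRight; lookup∘tabulate)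
open import Data.Fin using (Fin; zero; _↑ˡ_; _↑ʳ_; splitAt)
open import Data.Fin.Properties using (pigeonhole; splitAt-↑ˡ; splitAt-↑ʳ; splitAt⁻¹-↑ˡ; splitAt⁻¹-↑ʳ)
  renaming (<-irrefl to <-irreflᶠ)
open import Data.Sum using (_⊎_; inj₁; inj₂; [_,_]′)
open import Data.Product using (Σ; ∃; ∃₂; _×_; _,_; proj₁; proj₂)
open import Data.Empty using (⊥-elim)
open import Function using (_∘_)
open import Relation.Binary.PropositionalEquality
open import Relation.Nullary using (yes; no)

private variable m n d e s t : ℕ

⊕-assoc : (x y z : Vec Bool n) → (x ⊕ y) ⊕ z ≡ x ⊕ (y ⊕ z)
⊕-assoc = zipWith-assoc xor-assoc

⊕-comm : (x y : Vec Bool n) → x ⊕ y ≡ y ⊕ x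
⊕-comm = zipWith-comm xor-comm

⊕-identityˡ : (x : Vec Bool n) → zeroV n ⊕ x ≡ x
⊕-identityˡ = zipWith-identityˡ xor-identityˡ

⊕-identityʳ : (x : Vec Bool n) → x ⊕ zeroV n ≡ x
⊕-identityʳ = zipWith-identityʳ xor-identityʳ

⊕-self : (x : Vec Bool n) → x ⊕ x ≡ zeroV n
⊕-self []      = refl
⊕-self (b ∷ x) = cong₂ _∷_ (xor-same b) (⊕-self x)

⊕-cancelˡ : (x y : Vec Bool n) → x ⊕ (x ⊕ y) ≡ y
⊕-cancelˡ x y = begin
  x ⊕ (x ⊕ y)  ≡⟨ ⊕-assoc x x y ⟨
  (x ⊕ x) ⊕ y  ≡⟨ cong (_⊕ y) (⊕-self x) ⟩
  zeroV _ ⊕ y  ≡⟨ ⊕-identityˡ y ⟩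
  y            ∎
  where open ≡-Reasoning

⊕-cancelʳ : (x y : Vec Bool n) → (x ⊕ y) ⊕ y ≡ x
⊕-cancelʳ x y = begin
  (x ⊕ y) ⊕ y  ≡⟨ ⊕-assoc x y y ⟩
  x ⊕ (y ⊕ y)  ≡⟨ cong (x ⊕_) (⊕-self y) ⟩
  x ⊕ zeroV _  ≡⟨ ⊕-identityʳ x ⟩
  x            ∎
  where open ≡-Reasoning

⊕≡zero⇒≡ : {x y : Vec Bool n} → x ⊕ y ≡ zeroV n → x ≡ y
⊕≡zero⇒≡ {x = x} {y} eq = begin
  x            ≡⟨ ⊕-cancelʳ x y ⟨
  (x ⊕ y) ⊕ y  ≡⟨ cong (_⊕ y) eq ⟩
  zeroV _ ⊕ y  ≡⟨ ⊕-identityˡ y ⟩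
  y            ∎
  where open ≡-Reasoning

⊕-interchange : (a b c d : Vec Bool n) → (a ⊕ b) ⊕ (c ⊕ d) ≡ (a ⊕ c) ⊕ (b ⊕ d)
⊕-interchange a b c d = begin
  (a ⊕ b) ⊕ (c ⊕ d)  ≡⟨ ⊕-assoc a b (c ⊕ d) ⟩
  a ⊕ (b ⊕ (c ⊕ d))  ≡⟨ cong (a ⊕_) (⊕-assoc b c d) ⟨
  a ⊕ ((b ⊕ c) ⊕ d)  ≡⟨ cong (λ u → a ⊕ (u ⊕ d)) (⊕-comm b c) ⟩
  a ⊕ ((c ⊕ b) ⊕ d)  ≡⟨ cong (a ⊕_) (⊕-assoc c b d) ⟩
  a ⊕ (c ⊕ (b ⊕ d))  ≡⟨ ⊕-assoc a c (b ⊕ d) ⟨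
  (a ⊕ c) ⊕ (b ⊕ d)  ∎
  where open ≡-Reasoning

infixr 25 _·_
_·_ : Bool → Vec Bool n → Vec Bool n
_·_ {n} b x = if b then x else zeroV n

·-distribʳ-xor : (a b : Bool) (x : Vec Bool n) → (a xor b) · x ≡ a · x ⊕ b · x
·-distribʳ-xor false b    x = sym (⊕-identityˡ (b · x))
·-distribʳ-xor true false x = sym (⊕-identityʳ x)
·-distribʳ-xor true true  x = sym (⊕-self x)

++-⊕ : (x : Vec Bool m) (y : Vec Bool n) (x′ : Vec Bool m) (y′ : Vec Bool n) →
       (x ++ y) ⊕ (x′ ++ y′) ≡ (x ⊕ x′) ++ (y ⊕ y′)
++-⊕ = zipWith-++ _xor_

zero-++ : (m n : ℕ) → zeroV m ++ zeroV n ≡ zeroV (m + n)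
zero-++ zero    n = refl
zero-++ (suc m) n = cong (false ∷_) (zero-++ m n)

take-++ : {A : Set} (x : Vec A m) (y : Vec A n) → take m (x ++ y) ≡ x
take-++ []      y = refl
take-++ (a ∷ x) y = cong (a ∷_) (take-++ x y)

drop-++ : {A : Set} (x : Vec A m) (y : Vec A n) → drop m (x ++ y) ≡ y
drop-++ []      y = refl
drop-++ (a ∷ x) y = drop-++ x y

linear-zero : {f : Vec Bool m → Vec Bool n} → IsLinear f → f (zeroV m) ≡ zeroV n
linear-zero {m} {f = f} lin = begin
  f (zeroV m)                ≡⟨ cong f (⊕-self (zeroV m)) ⟨
  f (zeroV m ⊕ zeroV m)      ≡⟨ lin (zeroV m) (zeroV m) ⟩
  f (zeroV m) ⊕ f (zeroV m)  ≡⟨ ⊕-self (f (zeroV m)) ⟩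
  zeroV _                    ∎
  where open ≡-Reasoning

linear-· : {f : Vec Bool m → Vec Bool n} → IsLinear f → (b : Bool) (x : Vec Bool m) → f (b · x) ≡ b · f x
linear-· lin false x = linear-zero lin
linear-· lin true  x = refl

linearInjection-kernel : {f : Vec Bool m → Vec Bool n} → IsLinearInjection f →
                         {x : Vec Bool m} → f x ≡ zeroV n → x ≡ zeroV m
linearInjection-kernel (lin , inj) fx≡0 = inj _ _ (trans fx≡0 (sym (linear-zero lin)))

linearInjection-nonZero : {f : Vec Bool m → Vec Bool n} → IsLinearInjection f →
                          {x : Vec Bool m} → NonZero x → NonZero (f x)
linearInjection-nonZero f-li x≢0 fx≡0 = x≢0 (linearInjection-kernel f-li fx≡0)

trivialKernel⇒injective : {f : Vec Bool m → Vec Bool n} → IsLinear f →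
                          (∀ x → f x ≡ zeroV n → x ≡ zeroV m) → IsInjective f
trivialKernel⇒injective {f = f} lin ker x y fx≡fy =
  ⊕≡zero⇒≡ (ker (x ⊕ y) (trans (lin x y) (trans (cong (_⊕ f y) fx≡fy) (⊕-self (f y)))))

∘-linear : {f : Vec Bool n → Vec Bool s} {g : Vec Bool m → Vec Bool n} →
           IsLinear f → IsLinear g → IsLinear (f ∘ g)
∘-linear {f = f} f-lin g-lin x y = trans (cong f (g-lin x y)) (f-lin _ _)

∘-linearInjection : {f : Vec Bool n → Vec Bool s} {g : Vec Bool m → Vec Bool n} →
                    IsLinearInjection f → IsLinearInjection g → IsLinearInjection (f ∘ g)
∘-linearInjection (f-lin , f-inj) (g-lin , g-inj) =
  ∘-linear f-lin g-lin , (λ x y eq → g-inj x y (f-inj _ _ eq))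

++-linear : {f : Vec Bool m → Vec Bool n} {g : Vec Bool m → Vec Bool s} →
            IsLinear f → IsLinear g → IsLinear (λ x → f x ++ g x)
++-linear {f = f} {g} f-lin g-lin x y =
  trans (cong₂ _++_ (f-lin x y) (g-lin x y)) (sym (++-⊕ (f x) (g x) (f y) (g y)))

zero-linear : IsLinear (λ (_ : Vec Bool m) → zeroV n)
zero-linear {n = n} _ _ = sym (⊕-self (zeroV n))

embedˡ : (n : ℕ) → Vec Bool m → Vec Bool (m + n)
embedˡ n x = x ++ zeroV n

embedʳ : (m : ℕ) → Vec Bool n → Vec Bool (m + n)
embedʳ m x = zeroV m ++ x

embedˡ-linearInjection : IsLinearInjection (embedˡ {m} n)
embedˡ-linearInjection {n = n} =
  ++-linear {f = λ x → x} {g = λ _ → zeroV n} (λ _ _ → refl) zero-linear ,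
  λ x y → ++-injectiveˡ x y

embedʳ-linearInjection : IsLinearInjection (embedʳ {n} m)
embedʳ-linearInjection {m = m} =
  ++-linear {f = λ _ → zeroV m} {g = λ x → x} zero-linear (λ _ _ → refl) ,
  λ x y → ++-injectiveʳ (zeroV m) (zeroV m)

padRight-linearInjection : (m≤n : m ≤ n) → IsLinearInjection (padRight m≤n false)
padRight-linearInjection m≤n = linear m≤n , injective
  where
  linear : (m≤n : m ≤ n) → IsLinear (padRight m≤n false)
  linear z≤n       []      []      = sym (⊕-self (zeroV _))
  linear (s≤s m≤n) (a ∷ x) (b ∷ y) = cong ((a xor b) ∷_) (linear m≤n x y)
  injective : IsInjective (padRight m≤n false)
  injective x y eq = begin
    x                                    ≡⟨ truncate-padRight m≤n false x ⟨
    truncate m≤n (padRight m≤n false x)  ≡⟨ cong (truncate m≤n) eq ⟩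
    truncate m≤n (padRight m≤n false y)  ≡⟨ truncate-padRight m≤n false y ⟩
    y                                    ∎
    where open ≡-Reasoning

-- Subspaces as kernels

record Cokernel (e : ℕ) (ι : Vec Bool d → Vec Bool n) : Set where
  field
    quotient        : Vec Bool n → Vec Bool e
    retract         : Vec Bool n → Vec Bool d
    quotient-linear : IsLinear quotient
    retract-linear  : IsLinear retract
    retract-ι       : ∀ y → retract (ι y) ≡ y
    quotient-ι      : ∀ y → quotient (ι y) ≡ zeroV e
    ker-quotient    : ∀ x → quotient x ≡ zeroV e → ι (retract x) ≡ x

line : Vec Bool n → Vec Bool 1 → Vec Bool n
line w u = head u · w

head-⊕ : (x y : Vec Bool (suc n)) → head (x ⊕ y) ≡ head x xor head y
head-⊕ (a ∷ x) (b ∷ y) = refl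

·-false∷ : (b : Bool) (x : Vec Bool n) → b · (false ∷ x) ≡ false ∷ b · x
·-false∷ false x = refl
·-false∷ true  x = refl

lineCokernel : (w : Vec Bool (suc e)) → NonZero w → Cokernel e (line w)
lineCokernel {e} (true ∷ w) _ = record
  { quotient        = λ z → tail z ⊕ head z · w
  ; retract         = λ z → head z ∷ []
  ; quotient-linear = λ { (a ∷ x) (b ∷ y) →
      trans (cong ((x ⊕ y) ⊕_) (·-distribʳ-xor a b w)) (⊕-interchange x y (a · w) (b · w)) }
  ; retract-linear  = λ { (a ∷ x) (b ∷ y) → refl }
  ; retract-ι       = λ { (false ∷ []) → refl ; (true ∷ []) → refl }
  ; quotient-ι      = λ { (false ∷ []) → ⊕-self (zeroV e) ; (true ∷ []) → ⊕-self w }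
  ; ker-quotient    = ker-quotient
  }
  where
  ker-quotient : ∀ z → tail z ⊕ head z · w ≡ zeroV e → head z · (true ∷ w) ≡ z
  ker-quotient (false ∷ t) eq = cong (false ∷_) (sym (⊕≡zero⇒≡ eq))
  ker-quotient (true  ∷ t) eq = cong (true ∷_) (sym (⊕≡zero⇒≡ eq))
lineCokernel {zero}  (false ∷ []) w≢0 = ⊥-elim (w≢0 refl)
lineCokernel {suc e} (false ∷ w)  w≢0 = record
  { quotient        = λ z → head z ∷ L.quotient (tail z)
  ; retract         = λ z → L.retract (tail z)
  ; quotient-linear = λ { (a ∷ x) (b ∷ y) → cong ((a xor b) ∷_) (L.quotient-linear x y) }
  ; retract-linear  = λ { (a ∷ x) (b ∷ y) → L.retract-linear x y }
  ; retract-ι       = λ { (false ∷ []) → L.retract-ι (false ∷ []) ; (true ∷ []) → L.retract-ι (true ∷ []) }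
  ; quotient-ι      = λ { (false ∷ []) → cong (false ∷_) (L.quotient-ι (false ∷ []))
                        ; (true  ∷ []) → cong (false ∷_) (L.quotient-ι (true ∷ [])) }
  ; ker-quotient    = λ { (a ∷ t) eq → trans (·-false∷ (head (L.retract t)) w)
                            (cong₂ _∷_ (sym (cong head eq)) (L.ker-quotient t (cong tail eq))) }
  }
  where module L = Cokernel (lineCokernel w (λ w≡0 → w≢0 (cong (false ∷_) w≡0)))

-- The quotient for ι is the one for ι restricted to the hyperplane of vectors with first
-- coordinate 0, followed by dividing out the image of the remaining basis vector v.
cokernel-step : (ι : Vec Bool (suc d) → Vec Bool n) → IsLinearInjection ι →
                Cokernel (suc e) (λ y → ι (false ∷ y)) → Cokernel e ι
cokernel-step {d} {n} {e} ι (ι-lin , ι-inj) C = record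
  { quotient        = λ x → L.quotient (C.quotient x)
  ; retract         = retract
  ; quotient-linear = λ x y → trans (cong L.quotient (C.quotient-linear x y)) (L.quotient-linear _ _)
  ; retract-linear  = retract-linear
  ; retract-ι       = retract-ι
  ; quotient-ι      = λ { (b ∷ y) → trans (cong L.quotient (quotient-ι-split b y)) (L.quotient-ι (b ∷ [])) }
  ; ker-quotient    = ker-quotient
  }
  where
  module C = Cokernel C
  open ≡-Reasoning

  v : Vec Bool n
  v = ι (true ∷ zeroV d)

  w≢0 : NonZero (C.quotient v)
  w≢0 w≡0 with ι-inj _ _ (C.ker-quotient v w≡0)
  ... | ()

  module L = Cokernel (lineCokernel (C.quotient v) w≢0)

  coef : Vec Bool n → Bool
  coef x = head (L.retract (C.quotient x))

  retract : Vec Bool n → Vec Bool (suc d)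
  retract x = coef x ∷ C.retract (x ⊕ coef x · v)

  ι-split : ∀ b y → ι (b ∷ y) ≡ b · v ⊕ ι (false ∷ y)
  ι-split false y = sym (⊕-identityˡ _)
  ι-split true  y =
    trans (cong (λ u → ι (true ∷ u)) (sym (⊕-identityˡ y))) (ι-lin (true ∷ zeroV d) (false ∷ y))

  quotient-ι-split : ∀ b y → C.quotient (ι (b ∷ y)) ≡ b · C.quotient v
  quotient-ι-split b y = begin
    C.quotient (ι (b ∷ y))                           ≡⟨ cong C.quotient (ι-split b y) ⟩
    C.quotient (b · v ⊕ ι (false ∷ y))               ≡⟨ C.quotient-linear _ _ ⟩
    C.quotient (b · v) ⊕ C.quotient (ι (false ∷ y))
      ≡⟨ cong₂ _⊕_ (linear-· C.quotient-linear b v) (C.quotient-ι y) ⟩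
    b · C.quotient v ⊕ zeroV (suc e)                 ≡⟨ ⊕-identityʳ _ ⟩
    b · C.quotient v                                 ∎

  coef-ι : ∀ b y → coef (ι (b ∷ y)) ≡ b
  coef-ι b y =
    trans (cong (λ u → head (L.retract u)) (quotient-ι-split b y)) (cong head (L.retract-ι (b ∷ [])))

  coef-linear : ∀ x y → coef (x ⊕ y) ≡ coef x xor coef y
  coef-linear x y = begin
    head (L.retract (C.quotient (x ⊕ y)))
      ≡⟨ cong (λ u → head (L.retract u)) (C.quotient-linear x y) ⟩
    head (L.retract (C.quotient x ⊕ C.quotient y))
      ≡⟨ cong head (L.retract-linear _ _) ⟩
    head (L.retract (C.quotient x) ⊕ L.retract (C.quotient y))
      ≡⟨ head-⊕ (L.retract (C.quotient x)) _ ⟩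
    coef x xor coef y
      ∎

  retract-linear : IsLinear retract
  retract-linear x y = cong₂ _∷_ (coef-linear x y) (begin
    C.retract ((x ⊕ y) ⊕ coef (x ⊕ y) · v)
      ≡⟨ cong (λ b → C.retract ((x ⊕ y) ⊕ b · v)) (coef-linear x y) ⟩
    C.retract ((x ⊕ y) ⊕ (coef x xor coef y) · v)
      ≡⟨ cong (λ u → C.retract ((x ⊕ y) ⊕ u)) (·-distribʳ-xor _ _ v) ⟩
    C.retract ((x ⊕ y) ⊕ (coef x · v ⊕ coef y · v))
      ≡⟨ cong C.retract (⊕-interchange x y _ _) ⟩
    C.retract ((x ⊕ coef x · v) ⊕ (y ⊕ coef y · v))
      ≡⟨ C.retract-linear _ _ ⟩
    C.retract (x ⊕ coef x · v) ⊕ C.retract (y ⊕ coef y · v)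
      ∎)

  retract-ι : ∀ y → retract (ι y) ≡ y
  retract-ι (b ∷ y) = cong₂ _∷_ (coef-ι b y) (begin
    C.retract (ι (b ∷ y) ⊕ coef (ι (b ∷ y)) · v)
      ≡⟨ cong (λ c → C.retract (ι (b ∷ y) ⊕ c · v)) (coef-ι b y) ⟩
    C.retract (ι (b ∷ y) ⊕ b · v)
      ≡⟨ cong (λ u → C.retract (u ⊕ b · v)) (ι-split b y) ⟩
    C.retract ((b · v ⊕ ι (false ∷ y)) ⊕ b · v)
      ≡⟨ cong C.retract (trans (⊕-comm _ (b · v)) (⊕-cancelˡ _ _)) ⟩
    C.retract (ι (false ∷ y))
      ≡⟨ C.retract-ι y ⟩
    y ∎)

  ker-quotient : ∀ x → L.quotient (C.quotient x) ≡ zeroV e → ι (retract x) ≡ x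
  ker-quotient x eq = begin
    ι (retract x)
      ≡⟨ ι-split (coef x) _ ⟩
    coef x · v ⊕ ι (false ∷ C.retract (x ⊕ coef x · v))
      ≡⟨ cong (coef x · v ⊕_) (C.ker-quotient _ x+cv∈ker) ⟩
    coef x · v ⊕ (x ⊕ coef x · v)
      ≡⟨ cong (coef x · v ⊕_) (⊕-comm x _) ⟩
    coef x · v ⊕ (coef x · v ⊕ x)
      ≡⟨ ⊕-cancelˡ _ x ⟩
    x ∎
    where
    x+cv∈ker : C.quotient (x ⊕ coef x · v) ≡ zeroV (suc e)
    x+cv∈ker = begin
      C.quotient (x ⊕ coef x · v)                    ≡⟨ C.quotient-linear _ _ ⟩
      C.quotient x ⊕ C.quotient (coef x · v)
        ≡⟨ cong₂ _⊕_ (sym (L.ker-quotient _ eq)) (linear-· C.quotient-linear (coef x) v) ⟩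
      coef x · C.quotient v ⊕ coef x · C.quotient v  ≡⟨ ⊕-self _ ⟩
      zeroV (suc e)                                  ∎

cokernel : (ι : Vec Bool d → Vec Bool n) → IsLinearInjection ι → n ≤ d + e → Cokernel e ι
cokernel {zero} ι (ι-lin , _) n≤e = record
  { quotient        = padRight n≤e false
  ; retract         = λ _ → []
  ; quotient-linear = proj₁ pad-li
  ; retract-linear  = λ _ _ → refl
  ; retract-ι       = λ { [] → refl }
  ; quotient-ι      = λ { [] →
      trans (cong (padRight n≤e false) (linear-zero ι-lin)) (linear-zero (proj₁ pad-li)) }
  ; ker-quotient    = λ x eq → trans (linear-zero ι-lin) (sym (linearInjection-kernel pad-li eq))
  }
  where
  pad-li : IsLinearInjection (padRight n≤e false)
  pad-li = padRight-linearInjection n≤e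
cokernel {suc d} {n} {e} ι ι-li@(ι-lin , ι-inj) n≤d+e = cokernel-step ι ι-li
  (cokernel (λ y → ι (false ∷ y))
            ((λ x y → ι-lin (false ∷ x) (false ∷ y)) , (λ x y eq → cong tail (ι-inj _ _ eq)))
            (subst (n ≤_) (sym (+-suc d e)) n≤d+e))

-- Pigeonhole principle for Boolean vectors

2^_ : ℕ → ℕ
2^ zero  = 1
2^ suc n = 2^ n + 2^ n

toFin : Vec Bool n → Fin (2^ n)
toFin []                  = zero
toFin {suc n} (false ∷ x) = toFin x ↑ˡ 2^ n
toFin {suc n} (true  ∷ x) = 2^ n ↑ʳ toFin x

fromFin : Fin (2^ n) → Vec Bool n
fromFin {zero}  _ = []
fromFin {suc n} i = [ (λ j → false ∷ fromFin j) , (λ j → true ∷ fromFin j) ]′ (splitAt (2^ n) i)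

fromFin-toFin : (x : Vec Bool n) → fromFin (toFin x) ≡ x
fromFin-toFin []                  = refl
fromFin-toFin {suc n} (false ∷ x) rewrite splitAt-↑ˡ (2^ n) (toFin x) (2^ n) =
  cong (false ∷_) (fromFin-toFin x)
fromFin-toFin {suc n} (true  ∷ x) rewrite splitAt-↑ʳ (2^ n) (2^ n) (toFin x) =
  cong (true ∷_) (fromFin-toFin x)

toFin-fromFin : (i : Fin (2^ n)) → toFin (fromFin {n} i) ≡ i
toFin-fromFin {zero}  zero = refl
toFin-fromFin {suc n} i with splitAt (2^ n) i in eq
... | inj₁ j = trans (cong (_↑ˡ 2^ n) (toFin-fromFin {n} j)) (splitAt⁻¹-↑ˡ eq)
... | inj₂ j = trans (cong (2^ n ↑ʳ_) (toFin-fromFin {n} j)) (splitAt⁻¹-↑ʳ eq)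

2^-positive : ∀ n → 0 < 2^ n
2^-positive zero    = s≤s z≤n
2^-positive (suc n) = <-≤-trans (2^-positive n) (m≤m+n (2^ n) (2^ n))

collision : (F : Vec Bool (suc n) → Vec Bool n) → ∃₂ λ x y → x ≢ y × F x ≡ F y
collision {n} F with pigeonhole (m<m+n (2^ n) (2^-positive n)) (toFin ∘ F ∘ fromFin {suc n})
... | i , j , i<j , eq = fromFin {suc n} i , fromFin j , distinct , same
  where
  distinct : fromFin {suc n} i ≢ fromFin j
  distinct e =
    <-irreflᶠ (trans (sym (toFin-fromFin {suc n} i)) (trans (cong toFin e) (toFin-fromFin {suc n} j))) i<j
  same : F (fromFin {suc n} i) ≡ F (fromFin j)
  same = trans (sym (fromFin-toFin _)) (trans (cong (fromFin {n}) eq) (fromFin-toFin _))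

truthTable : (Vec Bool n → Bool) → Vec Bool (2^ n)
truthTable f = tabulate (f ∘ fromFin)

truthTable-injective : {f g : Vec Bool n → Bool} → truthTable f ≡ truthTable g → ∀ y → f y ≡ g y
truthTable-injective {f = f} {g} eq y = begin
  f y                                  ≡⟨ cong f (fromFin-toFin y) ⟨
  f (fromFin (toFin y))                ≡⟨ lookup∘tabulate (f ∘ fromFin) (toFin y) ⟨
  lookup (truthTable f) (toFin y)      ≡⟨ cong (λ table → lookup table (toFin y)) eq ⟩
  lookup (truthTable g) (toFin y)      ≡⟨ lookup∘tabulate (g ∘ fromFin) (toFin y) ⟩
  g (fromFin (toFin y))                ≡⟨ cong g (fromFin-toFin y) ⟩
  g y                                  ∎
  where open ≡-Reasoning

-- Ramsey theorem for colourings of F₂ˢ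

record MonochromaticCoset (t : ℕ) (c : Vec Bool s → Bool) : Set where
  field
    base                      : Vec Bool s
    direction                 : Vec Bool t → Vec Bool s
    direction-linearInjection : IsLinearInjection direction
    direction≢base            : ∀ y → direction y ≢ base
    coset-colour              : ∀ y → c (base ⊕ direction y) ≡ c base

monochromaticCoset : ∀ t → ∃ λ s → (c : Vec Bool s → Bool) → MonochromaticCoset t c
monochromaticCoset zero = 1 , λ c → record
  { base                      = true ∷ []
  ; direction                 = λ _ → false ∷ []
  ; direction-linearInjection = zero-linear , λ { [] [] _ → refl }
  ; direction≢base            = λ _ ()
  ; coset-colour              = λ _ → refl
  }
monochromaticCoset (suc t) = suc (2^ s′) + s′ , coset
  where
  s′ : ℕ
  s′ = proj₁ (monochromaticCoset t)

  -- Two distinct prefixes x₀, x₁ inducing the same colouring of their fibres give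
  -- a coset one dimension larger, in direction x₀ ⊕ x₁.
  coset : (c : Vec Bool (suc (2^ s′) + s′) → Bool) → MonochromaticCoset (suc t) c
  coset c with collision (λ x → truthTable (λ y → c (x ++ y)))
  ... | x₀ , x₁ , x₀≢x₁ , same-table = record
    { base                      = x₀ ++ C.base
    ; direction                 = direction
    ; direction-linearInjection = direction-linear , trivialKernel⇒injective direction-linear direction-kernel
    ; direction≢base            = λ { (b ∷ y) eq → C.direction≢base y (++-injectiveʳ _ _ eq) }
    ; coset-colour              = λ { (b ∷ y) →
        trans (cong c (++-⊕ x₀ C.base (b · δ) (C.direction y))) (trans (prefix-shift b _) (C.coset-colour y)) }
    }
    where
    module C = MonochromaticCoset (proj₂ (monochromaticCoset t) (λ y → c (x₀ ++ y)))

    δ : Vec Bool (suc (2^ s′))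
    δ = x₀ ⊕ x₁

    direction : Vec Bool (suc t) → Vec Bool (suc (2^ s′) + s′)
    direction (b ∷ y) = b · δ ++ C.direction y

    direction-linear : IsLinear direction
    direction-linear (a ∷ x) (b ∷ y) =
      trans (cong₂ _++_ (·-distribʳ-xor a b δ) (proj₁ C.direction-linearInjection x y))
            (sym (++-⊕ (a · δ) (C.direction x) (b · δ) (C.direction y)))

    direction-kernel : ∀ y → direction y ≡ zeroV _ → y ≡ zeroV (suc t)
    direction-kernel (b ∷ y) eq with ++-injective (b · δ) (zeroV _) (trans eq (sym (zero-++ _ s′)))
    ... | bδ≡0 , Cy≡0 with b
    ...   | false = cong (false ∷_) (linearInjection-kernel C.direction-linearInjection Cy≡0)
    ...   | true  = ⊥-elim (x₀≢x₁ (⊕≡zero⇒≡ bδ≡0))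

    prefix-shift : ∀ b z → c ((x₀ ⊕ b · δ) ++ z) ≡ c (x₀ ++ z)
    prefix-shift false z = cong (λ u → c (u ++ z)) (⊕-identityʳ x₀)
    prefix-shift true  z = trans (cong (λ u → c (u ++ z)) (⊕-cancelˡ x₀ x₁))
                                 (sym (truthTable-injective same-table z))

record Monochromatic (t : ℕ) (c : Vec Bool s → Bool) (i : Bool) : Set where
  field
    embedding                 : Vec Bool t → Vec Bool s
    embedding-linearInjection : IsLinearInjection embedding
    embedding-colour          : ∀ u → NonZero u → c (embedding u) ≡ i

monochromatic-zero : {c : Vec Bool s → Bool} {i : Bool} → Monochromatic 0 c i
monochromatic-zero = record
  { embedding                 = λ _ → zeroV _
  ; embedding-linearInjection = zero-linear , λ { [] [] _ → refl }
  ; embedding-colour          = λ { [] []≢0 → ⊥-elim ([]≢0 refl) }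
  }

monochromatic-map : {c : Vec Bool s → Bool} {i : Bool} {G : Vec Bool m → Vec Bool s} →
                    IsLinearInjection G → Monochromatic t (c ∘ G) i → Monochromatic t c i
monochromatic-map {G = G} G-li mono = record
  { embedding                 = G ∘ embedding
  ; embedding-linearInjection = ∘-linearInjection G-li embedding-linearInjection
  ; embedding-colour          = embedding-colour
  }
  where open Monochromatic mono

monochromatic-cone : {c : Vec Bool s → Bool} {i : Bool} (v : Vec Bool s) {G : Vec Bool m → Vec Bool s} →
                     IsLinearInjection G → (∀ y → G y ≢ v) → (∀ y → c (v ⊕ G y) ≡ i) →
                     Monochromatic t (c ∘ G) i → Monochromatic (suc t) c i
monochromatic-cone {c = c} {i} v {G} G-li G≢v cone-colour mono = record
  { embedding                 = embedding
  ; embedding-linearInjection = embedding-linear , trivialKernel⇒injective embedding-linear embedding-kernel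
  ; embedding-colour          = embedding-colour
  }
  where
  module M = Monochromatic mono

  H-li : IsLinearInjection (G ∘ M.embedding)
  H-li = ∘-linearInjection G-li M.embedding-linearInjection

  embedding : Vec Bool (suc _) → Vec Bool _
  embedding (b ∷ u) = b · v ⊕ G (M.embedding u)

  embedding-linear : IsLinear embedding
  embedding-linear (a ∷ x) (b ∷ y) =
    trans (cong₂ _⊕_ (·-distribʳ-xor a b v) (proj₁ H-li x y)) (⊕-interchange _ _ _ _)

  embedding-kernel : ∀ u → embedding u ≡ zeroV _ → u ≡ zeroV _
  embedding-kernel (false ∷ u) eq =
    cong (false ∷_) (linearInjection-kernel H-li (trans (sym (⊕-identityˡ _)) eq))
  embedding-kernel (true  ∷ u) eq = ⊥-elim (G≢v (M.embedding u) (sym (⊕≡zero⇒≡ eq)))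

  embedding-colour : ∀ u → NonZero u → c (embedding u) ≡ i
  embedding-colour (false ∷ u) u≢0 =
    trans (cong c (⊕-identityˡ _)) (M.embedding-colour u (u≢0 ∘ cong (false ∷_)))
  embedding-colour (true  ∷ u) _   = cone-colour (M.embedding u)

ramsey : ∀ t₀ t₁ → ∃ λ s → (c : Vec Bool s → Bool) → Monochromatic t₀ c false ⊎ Monochromatic t₁ c true
ramsey zero     t₁       = 0 , λ _ → inj₁ monochromatic-zero
ramsey (suc t₀) zero     = 0 , λ _ → inj₂ monochromatic-zero
ramsey (suc t₀) (suc t₁) = proj₁ (monochromaticCoset (s₀ + s₁)) , split
  where
  s₀ s₁ : ℕ
  s₀ = proj₁ (ramsey t₀ (suc t₁))
  s₁ = proj₁ (ramsey (suc t₀) t₁)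

  -- Inside the direction space of a monochromatic coset, a subspace of the colour of
  -- the base extends to the cone over the base, one dimension larger.
  split : (c : Vec Bool _ → Bool) → Monochromatic (suc t₀) c false ⊎ Monochromatic (suc t₁) c true
  split c = by-base-colour (c base) refl
    where
    open MonochromaticCoset (proj₂ (monochromaticCoset (s₀ + s₁)) c)

    Gˡ : Vec Bool s₀ → Vec Bool _
    Gˡ = direction ∘ embedˡ s₁
    Gʳ : Vec Bool s₁ → Vec Bool _
    Gʳ = direction ∘ embedʳ s₀

    Gˡ-li : IsLinearInjection Gˡ
    Gˡ-li = ∘-linearInjection direction-linearInjection embedˡ-linearInjection
    Gʳ-li : IsLinearInjection Gʳ
    Gʳ-li = ∘-linearInjection direction-linearInjection embedʳ-linearInjection

    by-base-colour : ∀ i → c base ≡ i → Monochromatic (suc t₀) c false ⊎ Monochromatic (suc t₁) c true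
    by-base-colour false base-colour with proj₂ (ramsey t₀ (suc t₁)) (c ∘ Gˡ)
    ... | inj₁ mono = inj₁ (monochromatic-cone base Gˡ-li (λ _ → direction≢base _)
                                               (λ _ → trans (coset-colour _) base-colour) mono)
    ... | inj₂ mono = inj₂ (monochromatic-map Gˡ-li mono)
    by-base-colour true  base-colour with proj₂ (ramsey (suc t₀) t₁) (c ∘ Gʳ)
    ... | inj₁ mono = inj₁ (monochromatic-map Gʳ-li mono)
    ... | inj₂ mono = inj₂ (monochromatic-cone base Gʳ-li (λ _ → direction≢base _)
                                               (λ _ → trans (coset-colour _) base-colour) mono)

applyMatrix : Vec Bool (s * t) → Vec Bool s → Vec Bool t
applyMatrix {zero}      _ []      = zeroV _
applyMatrix {suc s} {t} A (b ∷ p) = b · take t A ⊕ applyMatrix (drop t A) p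

matrixOf : (Vec Bool s → Vec Bool t) → Vec Bool (s * t)
matrixOf {zero}  K = []
matrixOf {suc s} K = K (true ∷ zeroV s) ++ matrixOf (λ p → K (false ∷ p))

applyMatrix-matrixOf : {K : Vec Bool s → Vec Bool t} → IsLinear K → ∀ p → applyMatrix (matrixOf K) p ≡ K p
applyMatrix-matrixOf {zero}          lin []      = sym (linear-zero lin)
applyMatrix-matrixOf {suc s} {t} {K} lin (b ∷ p) = begin
  b · take t (K e₀ ++ A) ⊕ applyMatrix (drop t (K e₀ ++ A)) p
    ≡⟨ cong₂ (λ u A′ → b · u ⊕ applyMatrix A′ p) (take-++ (K e₀) A) (drop-++ (K e₀) A) ⟩
  b · K e₀ ⊕ applyMatrix A p
    ≡⟨ cong₂ _⊕_ (sym (linear-· lin b e₀)) (applyMatrix-matrixOf (λ x y → lin (false ∷ x) (false ∷ y)) p) ⟩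
  K (b · e₀) ⊕ K (false ∷ p)    ≡⟨ lin (b · e₀) (false ∷ p) ⟨
  K (b · e₀ ⊕ (false ∷ p))      ≡⟨ cong K (decompose b) ⟩
  K (b ∷ p)                     ∎
  where
  open ≡-Reasoning
  e₀ : Vec Bool (suc s)
  e₀ = true ∷ zeroV s
  A : Vec Bool (s * t)
  A = matrixOf (λ p → K (false ∷ p))
  decompose : ∀ b → b · e₀ ⊕ (false ∷ p) ≡ b ∷ p
  decompose false = ⊕-identityˡ (false ∷ p)
  decompose true  = cong (true ∷_) (⊕-identityˡ p)

infixr 25 _⊗_
_⊗_ : Vec Bool m → Vec Bool n → Vec Bool (m * n)
[]      ⊗ κ = []
(b ∷ a) ⊗ κ = b · κ ++ a ⊗ κ

⊗-linearˡ : (κ : Vec Bool n) → IsLinear {m} (_⊗ κ)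
⊗-linearˡ κ []      []      = refl
⊗-linearˡ κ (a ∷ x) (b ∷ y) =
  trans (cong₂ _++_ (·-distribʳ-xor a b κ) (⊗-linearˡ κ x y)) (sym (++-⊕ (a · κ) (x ⊗ κ) (b · κ) (y ⊗ κ)))

leadingBlock : Vec Bool m → Vec Bool (m * n) → Vec Bool n
leadingBlock         []          _ = zeroV _
leadingBlock {n = n} (true  ∷ _) q = take n q
leadingBlock {n = n} (false ∷ a) q = leadingBlock a (drop n q)

leadingBlock-⊗ : (a : Vec Bool m) (κ : Vec Bool n) → NonZero a → leadingBlock a (a ⊗ κ) ≡ κ
leadingBlock-⊗         []          κ a≢0 = ⊥-elim (a≢0 refl)
leadingBlock-⊗         (true  ∷ a) κ _   = take-++ κ (a ⊗ κ)
leadingBlock-⊗ {n = n} (false ∷ a) κ a≢0 =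
  trans (cong (leadingBlock a) (drop-++ (zeroV n) (a ⊗ κ))) (leadingBlock-⊗ a κ (a≢0 ∘ cong (false ∷_)))

module RamseyPattern (k : ℕ) (N₀ N₁ : Matroid) where

  T S L R : ℕ
  T = dim N₀ + dim N₁
  S = proj₁ (ramsey T T)
  L = suc (S * T)
  R = S + k * L

  sideFun : Bool → Vec Bool T → Bool
  sideFun false y = fun N₀ (take (dim N₀) y)
  sideFun true  y = fun N₁ (drop (dim N₀) y)

  decode : Vec Bool k → Vec Bool R → Bool
  decode a r = sideFun (head κ) (applyMatrix (tail κ) (take S r))
    where
    κ : Vec Bool L
    κ = leadingBlock a (drop S r)

  B-at : Vec Bool k → Vec Bool R → PVal
  B-at a r with ≡-dec _≟_ a (zeroV k)
  ... | yes _ = ⋆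
  ... | no  _ = val (decode a r)

  B : Pattern
  B = mkPattern (k + R) (λ x → B-at (take k x) (drop k x))

  B-at-zero : ∀ r → B-at (zeroV k) r ≡ ⋆
  B-at-zero r with ≡-dec _≟_ (zeroV k) (zeroV k)
  ... | yes _   = refl
  ... | no  0≢0 = ⊥-elim (0≢0 refl)

  B-at-⋆ : ∀ a r → B-at a r ≡ ⋆ → a ≡ zeroV k
  B-at-⋆ a r _  with ≡-dec _≟_ a (zeroV k)
  B-at-⋆ a r _  | yes a≡0 = a≡0
  B-at-⋆ a r () | no  _

  B-at-nonZero : ∀ {a} r → NonZero a → B-at a r ≡ val (decode a r)
  B-at-nonZero {a} r a≢0 with ≡-dec _≟_ a (zeroV k)
  ... | yes a≡0 = ⊥-elim (a≢0 a≡0)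
  ... | no  _   = refl

  B-++ : ∀ a r → pfun B (a ++ r) ≡ B-at a r
  B-++ a r = cong₂ B-at (take-++ a r) (drop-++ a r)

  B-affine : IsAffine k B
  B-affine = R , embedʳ k , embedʳ-linearInjection , +-comm R k , λ x _ → ⋆⇒∈ x , ∈⇒⋆
    where
    ⋆⇒∈ : ∀ x → pfun B x ≡ ⋆ → ∃ λ y → embedʳ k y ≡ x
    ⋆⇒∈ x eq = drop k x , trans (cong (_++ drop k x) (sym (B-at-⋆ _ _ eq))) (take++drop≡id k x)
    ∈⇒⋆ : ∀ {x} → (∃ λ y → embedʳ k y ≡ x) → pfun B x ≡ ⋆
    ∈⇒⋆ (y , refl) = trans (B-++ (zeroV k) y) (B-at-zero y)

  decode-encoding : ∀ {a} (p : Vec Bool S) (i : Bool) {K : Vec Bool S → Vec Bool T} →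
                    IsLinear K → NonZero a → decode a (p ++ a ⊗ (i ∷ matrixOf K)) ≡ sideFun i (K p)
  decode-encoding {a} p i {K} lin a≢0 = begin
    decode a (p ++ a ⊗ κ)
      ≡⟨ cong₂ (λ κ′ p′ → sideFun (head κ′) (applyMatrix (tail κ′) p′))
               (trans (cong (leadingBlock a) (drop-++ p (a ⊗ κ))) (leadingBlock-⊗ a κ a≢0)) (take-++ p (a ⊗ κ)) ⟩
    sideFun i (applyMatrix (matrixOf K) p)  ≡⟨ cong (sideFun i) (applyMatrix-matrixOf lin p) ⟩
    sideFun i (K p)                         ∎
    where
    open ≡-Reasoning
    κ : Vec Bool L
    κ = i ∷ matrixOf K

  module _ (g : Vec Bool (k + R) → Bool) (g-eval : IsEvaluation B g) where

    colour : Vec Bool S → Bool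
    colour p = g (zeroV k ++ (p ++ zeroV (k * L)))

    monochromatic⇒instance : (i : Bool) {N : Matroid} → InM k i N →
                             (ε : Vec Bool (dim N) → Vec Bool T) → IsLinearInjection ε →
                             (∀ x → sideFun i (ε x) ≡ fun N x) →
                             Monochromatic T colour i → Instance N (mkMatroid (k + R) g)
    monochromatic⇒instance i {N} (d , ι , ι-li , dimN≤d+k , ι-colour) ε ε-li ε-fun mono = φ , φ-li , φ-value
      where
      open Monochromatic mono
      module Q = Cokernel (cokernel ι ι-li dimN≤d+k)
      module E = Cokernel (cokernel embedding embedding-linearInjection (m≤n+m S T))
      open ≡-Reasoning

      μ-li : IsLinearInjection (embedding ∘ ε)
      μ-li = ∘-linearInjection embedding-linearInjection ε-li

      κ : Vec Bool L
      κ = i ∷ matrixOf E.retract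

      φ : Vec Bool (dim N) → Vec Bool (k + R)
      φ x = Q.quotient x ++ (embedding (ε x) ++ Q.quotient x ⊗ κ)

      φ-li : IsLinearInjection φ
      φ-li = ++-linear {f = Q.quotient} Q.quotient-linear
               (++-linear {f = embedding ∘ ε} (proj₁ μ-li) (∘-linear {f = _⊗ κ} (⊗-linearˡ κ) Q.quotient-linear))
           , λ x y eq → proj₂ μ-li x y
               (++-injectiveˡ (embedding (ε x)) _ (++-injectiveʳ (Q.quotient x) (Q.quotient y) eq))

      φ-value : ∀ x → NonZero x → g (φ x) ≡ fun N x
      φ-value x x≢0 with ≡-dec _≟_ (Q.quotient x) (zeroV k)
      ... | yes qx≡0 = begin
        g (φ x)                        ≡⟨ cong g φx≡ ⟩
        colour (embedding (ε x))       ≡⟨ embedding-colour (ε x) (linearInjection-nonZero ε-li x≢0) ⟩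
        i                              ≡⟨ ι-colour (Q.retract x) retract≢0 ⟨
        fun N (ι (Q.retract x))        ≡⟨ cong (fun N) (Q.ker-quotient x qx≡0) ⟩
        fun N x                        ∎
        where
        φx≡ : φ x ≡ zeroV k ++ (embedding (ε x) ++ zeroV (k * L))
        φx≡ = trans (cong (λ a → a ++ (embedding (ε x) ++ a ⊗ κ)) qx≡0)
                    (cong (λ q → zeroV k ++ (embedding (ε x) ++ q)) (linear-zero (⊗-linearˡ {m = k} κ)))
        retract≢0 : NonZero (Q.retract x)
        retract≢0 r≡0 =
          x≢0 (trans (sym (Q.ker-quotient x qx≡0)) (trans (cong ι r≡0) (linear-zero (proj₁ ι-li))))
      ... | no qx≢0 = begin
        g (φ x)
          ≡⟨ g-eval (φ x) (linearInjection-nonZero φ-li x≢0) _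
                    (trans (B-++ (Q.quotient x) _) (B-at-nonZero _ qx≢0)) ⟩
        decode (Q.quotient x) (embedding (ε x) ++ Q.quotient x ⊗ κ)
          ≡⟨ decode-encoding (embedding (ε x)) i E.retract-linear qx≢0 ⟩
        sideFun i (E.retract (embedding (ε x)))
          ≡⟨ cong (sideFun i) (E.retract-ι (ε x)) ⟩
        sideFun i (ε x)
          ≡⟨ ε-fun x ⟩
        fun N x
          ∎

    evaluation-contains-instance : InM k false N₀ → InM k true N₁ →
                                   Instance N₀ (mkMatroid (k + R) g) ⊎ Instance N₁ (mkMatroid (k + R) g)
    evaluation-contains-instance h₀ h₁ with proj₂ (ramsey T T) colour
    ... | inj₁ mono = inj₁ (monochromatic⇒instance false h₀ (embedˡ (dim N₁)) embedˡ-linearInjection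
                                                   (λ x → cong (fun N₀) (take-++ x (zeroV (dim N₁)))) mono)
    ... | inj₂ mono = inj₂ (monochromatic⇒instance true h₁ (embedʳ (dim N₀)) embedʳ-linearInjection
                                                   (λ x → cong (fun N₁) (drop-++ (zeroV (dim N₀)) x)) mono)

lemma3p4 : (k : ℕ) → 1 ≤ k → (N₀ N₁ : Matroid) → InM k false N₀ → InM k true N₁ →
    Σ Pattern λ B → IsAffine k B ×
      ((g : Vec→Bool B) → IsEvaluation B g →
        Instance N₀ (mkMatroid (pdim B) g) ⊎ Instance N₁ (mkMatroid (pdim B) g))
lemma3p4 k _ N₀ N₁ h₀ h₁ = B , B-affine , λ g g-eval → evaluation-contains-instance g g-eval h₀ h₁
  where open RamseyPattern k N₀ N₁
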